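{- Let $\mathcal{C}\subseteq M_n(\mathbb{F})$ be a commutative homogeneous coherent algebra. Then \[\mathcal{J}(\mathcal{C}):=\left\{\begin{bmatrix}A&B\\ C&A\end{bmatrix}\;:\;A,B,C\in\mathcal{C}\right\}\subseteq M_{2n}(\mathbb{F})\] is a homogeneous coherent Jordan algebra.
   Context: $\mathbb{F}$ is a field with $\mathrm{char}\,\mathbb{F}\neq 2$; $A\circ B$ denotes the entrywise (Schur–Hadamard) product and $A\star B=\tfrac12(AB+BA)$ the Jordan product; $I$ and $J$ denote identity and all-ones matrices. A coherent algebra is a linear subspace of $M_n(\mathbb{F})$ containing $I$ and $J$ and closed under transposition, $\circ$ and ordinary matrix multiplication; a coherent Jordan algebra is a linear subspace containing $I$ and $J$ and closed under transposition, $\circ$ and $\star$. Such a subspace $\mathcal{A}$ is homogeneous if $\langle I\rangle\circ\mathcal{A}\subseteq\langle I\rangle$, and commutative if its elements pairwise commute. -}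

module Defs where

open import Level using (Level; _⊔_; suc)
open import Data.Nat using (ℕ; zero) renaming (suc to sucℕ; _+_ to _+ℕ_)
open import Data.Fin using (Fin; splitAt; _≟_) renaming (zero to fz; suc to fs)
open import Data.Sum using (_⊎_; inj₁; inj₂)
open import Data.Product using (Σ; ∃; _×_; _,_; proj₁)
open import Relation.Nullary using (¬_; yes; no)
open import Algebra.Bundles using (CommutativeRing)

record Field (c ℓ : Level) : Set (suc (c ⊔ ℓ)) where
  field
    commutativeRing : CommutativeRing c ℓ
  open CommutativeRing commutativeRing public
  field
    1≉0     : ¬ (1# ≈ 0#)
    inverse : ∀ x → ¬ (x ≈ 0#) → Σ Carrier (λ y → x * y ≈ 1#)

module MatrixTheory {c ℓ : Level} (F : Field c ℓ) where
  open Field F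

  CharNot2 : Set ℓ
  CharNot2 = ¬ ((1# + 1#) ≈ 0#)

  Mat : ℕ → Set c
  Mat n = Fin n → Fin n → Carrier

  _≋_ : ∀ {n} → Mat n → Mat n → Set ℓ
  A ≋ B = ∀ i j → A i j ≈ B i j

  sumF : ∀ {n} → (Fin n → Carrier) → Carrier
  sumF {zero}   f = 0#
  sumF {sucℕ n} f = f fz + sumF (λ i → f (fs i))

  I : ∀ {n} → Mat n
  I i j with i ≟ j
  ... | yes _ = 1#
  ... | no  _ = 0#

  Jm : ∀ {n} → Mat n
  Jm i j = 1#

  0M : ∀ {n} → Mat n
  0M i j = 0#

  _⊕_ : ∀ {n} → Mat n → Mat n → Mat n
  (A ⊕ B) i j = A i j + B i j

  _·_ : ∀ {n} → Carrier → Mat n → Mat n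
  (a · A) i j = a * A i j

  _ᵀ : ∀ {n} → Mat n → Mat n
  (A ᵀ) i j = A j i

  _∘_ : ∀ {n} → Mat n → Mat n → Mat n
  (A ∘ B) i j = A i j * B i j

  _⊗_ : ∀ {n} → Mat n → Mat n → Mat n
  (A ⊗ B) i j = sumF (λ k → A i k * B k j)

  half : CharNot2 → Carrier
  half h = proj₁ (inverse (1# + 1#) h)

  jordan : CharNot2 → ∀ {n} → Mat n → Mat n → Mat n
  jordan h A B = half h · ((A ⊗ B) ⊕ (B ⊗ A))

  record IsSubspace {p} (n : ℕ) (𝒜 : Mat n → Set p) : Set (c ⊔ ℓ ⊔ p) where
    field
      resp  : ∀ {A B} → A ≋ B → 𝒜 A → 𝒜 B
      zero∈ : 𝒜 0M
      +∈    : ∀ {A B} → 𝒜 A → 𝒜 B → 𝒜 (A ⊕ B)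
      ·∈    : ∀ a {A} → 𝒜 A → 𝒜 (a · A)

  InSpanI : ∀ {n} → Mat n → Set (c ⊔ ℓ)
  InSpanI A = Σ Carrier (λ a → A ≋ (a · I))

  record IsCoherentAlgebra {p} (n : ℕ) (𝒜 : Mat n → Set p) : Set (c ⊔ ℓ ⊔ p) where
    field
      subspace : IsSubspace n 𝒜
      I∈       : 𝒜 I
      J∈       : 𝒜 Jm
      ᵀ∈       : ∀ {A} → 𝒜 A → 𝒜 (A ᵀ)
      ∘∈       : ∀ {A B} → 𝒜 A → 𝒜 B → 𝒜 (A ∘ B)
      ⊗∈       : ∀ {A B} → 𝒜 A → 𝒜 B → 𝒜 (A ⊗ B)

  record IsCoherentJordanAlgebra (h : CharNot2) {p} (n : ℕ) (𝒜 : Mat n → Set p) : Set (c ⊔ ℓ ⊔ p) where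
    field
      subspace : IsSubspace n 𝒜
      I∈       : 𝒜 I
      J∈       : 𝒜 Jm
      ᵀ∈       : ∀ {A} → 𝒜 A → 𝒜 (A ᵀ)
      ∘∈       : ∀ {A B} → 𝒜 A → 𝒜 B → 𝒜 (A ∘ B)
      ⋆∈       : ∀ {A B} → 𝒜 A → 𝒜 B → 𝒜 (jordan h A B)

  IsHomogeneous : ∀ {p} (n : ℕ) (𝒜 : Mat n → Set p) → Set (c ⊔ ℓ ⊔ p)
  IsHomogeneous n 𝒜 = ∀ {X A} → InSpanI X → 𝒜 A → InSpanI (X ∘ A)

  IsCommutative : ∀ {p} (n : ℕ) (𝒜 : Mat n → Set p) → Set (c ⊔ ℓ ⊔ p)
  IsCommutative n 𝒜 = ∀ {A B} → 𝒜 A → 𝒜 B → (A ⊗ B) ≋ (B ⊗ A)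

  block : ∀ {n} → Mat n → Mat n → Mat n → Mat n → Mat (n +ℕ n)
  block {n} A B C D i j with splitAt n i | splitAt n j
  ... | inj₁ i' | inj₁ j' = A i' j'
  ... | inj₁ i' | inj₂ j' = B i' j'
  ... | inj₂ i' | inj₁ j' = C i' j'
  ... | inj₂ i' | inj₂ j' = D i' j'

  𝒥 : ∀ {p} {n : ℕ} → (Mat n → Set p) → Mat (n +ℕ n) → Set (c ⊔ ℓ ⊔ p)
  𝒥 {n = n} 𝒞 M = Σ (Mat n) λ A → Σ (Mat n) λ B → Σ (Mat n) λ C →
                   𝒞 A × 𝒞 B × 𝒞 C × (M ≋ block A B C A)

-- Sums, scalar multiples, Schur products and transposes of block matrices are computed
-- blockwise (transposition also swapping the two off-diagonal blocks), so 𝒥(𝒞) inherits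
-- these closures from 𝒞, and I = [I 0; 0 I], J = [J J; J J] lie in it. For the Jordan
-- product of [A B; C A] and [A′ B′; C′ A′], the two diagonal blocks are
-- ½(AA′ + BC′ + A′A + B′C) and ½(CB′ + AA′ + C′B + A′A), which agree because 𝒞 is
-- commutative; the off-diagonal blocks are sums of products of elements of 𝒞. Finally a
-- multiple of I, Schur-multiplied with [A B; C A], only sees the diagonal blocks A, and
-- (aI) ∘ A is again a multiple of I by homogeneity of 𝒞.
module Submission where

open import Defs
open import Level using (Level)
open import Data.Nat using (ℕ; _+_)
open import Data.Product using (_×_; _,_)
open import Data.Fin using (Fin; splitAt; _↑ˡ_; _↑ʳ_; _≟_) renaming (zero to fz; suc to fs)
open import Data.Fin.Properties
  using (splitAt-↑ˡ; splitAt-↑ʳ; splitAt⁻¹-↑ˡ; splitAt⁻¹-↑ʳ; ↑ˡ-injective; ↑ʳ-injective)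
open import Data.Sum using (inj₁; inj₂)
open import Data.Empty using (⊥-elim)
open import Function.Definitions using (Injective)
open import Relation.Nullary using (yes; no)
open import Relation.Binary.Bundles using (Setoid)
open import Relation.Binary.PropositionalEquality as ≡ using (_≡_; _≢_; refl)
import Relation.Binary.Reasoning.Setoid as SetoidReasoning

splitAt-elim : ∀ {q} {m k} {Q : Fin (m + k) → Set q} →
  (∀ i → Q (i ↑ˡ k)) → (∀ j → Q (m ↑ʳ j)) → ∀ i → Q i
splitAt-elim {m = m} {Q = Q} left right i with splitAt m i in eq
... | inj₁ i′ = ≡.subst Q (splitAt⁻¹-↑ˡ eq) (left i′)
... | inj₂ j′ = ≡.subst Q (splitAt⁻¹-↑ʳ eq) (right j′)

↑ˡ≢↑ʳ : ∀ {m k} (i : Fin m) (j : Fin k) → i ↑ˡ k ≢ m ↑ʳ j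
↑ˡ≢↑ʳ {m} {k} i j eq with ≡.trans (≡.sym (splitAt-↑ˡ m i k))
                                   (≡.trans (≡.cong (splitAt m) eq) (splitAt-↑ʳ m k j))
... | ()

module BlockMatrices {c ℓ : Level} (F : Field c ℓ) where

  open Field F
    renaming (_+_ to _+ᶠ_; _*_ to _*ᶠ_; refl to ≈-refl; sym to ≈-sym; trans to ≈-trans)
  open MatrixTheory F

  +-rotate : ∀ p q r s → (p +ᶠ q) +ᶠ (r +ᶠ s) ≈ (q +ᶠ r) +ᶠ (s +ᶠ p)
  +-rotate p q r s = begin
    (p +ᶠ q) +ᶠ (r +ᶠ s)  ≈⟨ +-assoc p q (r +ᶠ s) ⟩
    p +ᶠ (q +ᶠ (r +ᶠ s))  ≈⟨ +-cong ≈-refl (+-assoc q r s) ⟨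
    p +ᶠ ((q +ᶠ r) +ᶠ s)  ≈⟨ +-comm p _ ⟩
    ((q +ᶠ r) +ᶠ s) +ᶠ p  ≈⟨ +-assoc (q +ᶠ r) s p ⟩
    (q +ᶠ r) +ᶠ (s +ᶠ p)  ∎
    where open SetoidReasoning setoid

  sumF-cong : ∀ {m} {f g : Fin m → Carrier} → (∀ k → f k ≈ g k) → sumF f ≈ sumF g
  sumF-cong {ℕ.zero}  f≈g = ≈-refl
  sumF-cong {ℕ.suc m} f≈g = +-cong (f≈g fz) (sumF-cong (λ k → f≈g (fs k)))

  sumF-splitAt : ∀ m k (f : Fin (m + k) → Carrier) →
    sumF f ≈ sumF (λ i → f (i ↑ˡ k)) +ᶠ sumF (λ j → f (m ↑ʳ j))
  sumF-splitAt ℕ.zero    k f = ≈-sym (+-identityˡ _)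
  sumF-splitAt (ℕ.suc m) k f =
    ≈-trans (+-cong ≈-refl (sumF-splitAt m k (λ i → f (fs i)))) (≈-sym (+-assoc _ _ _))

  ≋-setoid : ℕ → Setoid c ℓ
  ≋-setoid n = record
    { Carrier       = Mat n
    ; _≈_           = _≋_
    ; isEquivalence = record
      { refl  = λ i j → ≈-refl
      ; sym   = λ A≋B i j → ≈-sym (A≋B i j)
      ; trans = λ A≋B B≋C i j → ≈-trans (A≋B i j) (B≋C i j)
      }
    }

  module _ {n : ℕ} where
    open Setoid (≋-setoid n) public
      using () renaming (refl to ≋-refl; sym to ≋-sym; trans to ≋-trans)

  zipWithᴹ : ∀ {n} → (Carrier → Carrier → Carrier) → Mat n → Mat n → Mat n
  zipWithᴹ f A B i j = f (A i j) (B i j)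

  ⊕-cong : ∀ {n} {A A′ B B′ : Mat n} → A ≋ A′ → B ≋ B′ → (A ⊕ B) ≋ (A′ ⊕ B′)
  ⊕-cong A≋A′ B≋B′ i j = +-cong (A≋A′ i j) (B≋B′ i j)

  ∘-cong : ∀ {n} {A A′ B B′ : Mat n} → A ≋ A′ → B ≋ B′ → (A ∘ B) ≋ (A′ ∘ B′)
  ∘-cong A≋A′ B≋B′ i j = *-cong (A≋A′ i j) (B≋B′ i j)

  ·-cong : ∀ {n} a {A A′ : Mat n} → A ≋ A′ → (a · A) ≋ (a · A′)
  ·-cong a A≋A′ i j = *-cong ≈-refl (A≋A′ i j)

  ⊗-cong : ∀ {n} {A A′ B B′ : Mat n} → A ≋ A′ → B ≋ B′ → (A ⊗ B) ≋ (A′ ⊗ B′)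
  ⊗-cong A≋A′ B≋B′ i j = sumF-cong (λ k → *-cong (A≋A′ i k) (B≋B′ k j))

  jordan-cong : ∀ (h : CharNot2) {n} {A A′ B B′ : Mat n} → A ≋ A′ → B ≋ B′ →
    jordan h A B ≋ jordan h A′ B′
  jordan-cong h A≋A′ B≋B′ = ·-cong (half h) (⊕-cong (⊗-cong A≋A′ B≋B′) (⊗-cong B≋B′ A≋A′))

  I-injective : ∀ {m k} {f : Fin m → Fin k} → Injective _≡_ _≡_ f →
    ∀ i j → I (f i) (f j) ≡ I i j
  I-injective {f = f} f-inj i j with f i ≟ f j | i ≟ j
  ... | yes _       | yes _   = refl
  ... | yes fi≡fj   | no  i≢j = ⊥-elim (i≢j (f-inj fi≡fj))
  ... | no  fi≢fj   | yes i≡j = ⊥-elim (fi≢fj (≡.cong f i≡j))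
  ... | no  _       | no  _   = refl

  I-≢ : ∀ {m} {i j : Fin m} → i ≢ j → I i j ≡ 0#
  I-≢ {i = i} {j} i≢j with i ≟ j
  ... | yes i≡j = ⊥-elim (i≢j i≡j)
  ... | no  _   = refl

  module Blocks (n : ℕ) where

    module _ (A B C D : Mat n) (i j : Fin n) where

      block-↑ˡ-↑ˡ : block A B C D (i ↑ˡ n) (j ↑ˡ n) ≡ A i j
      block-↑ˡ-↑ˡ rewrite splitAt-↑ˡ n i n | splitAt-↑ˡ n j n = refl

      block-↑ˡ-↑ʳ : block A B C D (i ↑ˡ n) (n ↑ʳ j) ≡ B i j
      block-↑ˡ-↑ʳ rewrite splitAt-↑ˡ n i n | splitAt-↑ʳ n n j = refl

      block-↑ʳ-↑ˡ : block A B C D (n ↑ʳ i) (j ↑ˡ n) ≡ C i j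
      block-↑ʳ-↑ˡ rewrite splitAt-↑ʳ n n i | splitAt-↑ˡ n j n = refl

      block-↑ʳ-↑ʳ : block A B C D (n ↑ʳ i) (n ↑ʳ j) ≡ D i j
      block-↑ʳ-↑ʳ rewrite splitAt-↑ʳ n n i | splitAt-↑ʳ n n j = refl

    block-intro : ∀ {M : Mat (n + n)} {A B C D : Mat n} →
      (∀ i j → M (i ↑ˡ n) (j ↑ˡ n) ≈ A i j) → (∀ i j → M (i ↑ˡ n) (n ↑ʳ j) ≈ B i j) →
      (∀ i j → M (n ↑ʳ i) (j ↑ˡ n) ≈ C i j) → (∀ i j → M (n ↑ʳ i) (n ↑ʳ j) ≈ D i j) →
      M ≋ block A B C D
    block-intro {A = A} {B} {C} {D} ul ur dl dr =
      splitAt-elim (λ i → splitAt-elim (λ j → back (ul i j) (block-↑ˡ-↑ˡ A B C D i j))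
                                        (λ j → back (ur i j) (block-↑ˡ-↑ʳ A B C D i j)))
                   (λ i → splitAt-elim (λ j → back (dl i j) (block-↑ʳ-↑ˡ A B C D i j))
                                        (λ j → back (dr i j) (block-↑ʳ-↑ʳ A B C D i j)))
      where
        back : ∀ {x y z} → x ≈ y → z ≡ y → x ≈ z
        back x≈y z≡y = ≈-trans x≈y (≈-sym (reflexive z≡y))

    block-cong : ∀ {A A′ B B′ C C′ D D′ : Mat n} →
      A ≋ A′ → B ≋ B′ → C ≋ C′ → D ≋ D′ → block A B C D ≋ block A′ B′ C′ D′
    block-cong A≋A′ B≋B′ C≋C′ D≋D′ i j with splitAt n i | splitAt n j
    ... | inj₁ i′ | inj₁ j′ = A≋A′ i′ j′
    ... | inj₁ i′ | inj₂ j′ = B≋B′ i′ j′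
    ... | inj₂ i′ | inj₁ j′ = C≋C′ i′ j′
    ... | inj₂ i′ | inj₂ j′ = D≋D′ i′ j′

    block-zipWith : ∀ f {A B C D A′ B′ C′ D′ : Mat n} →
      zipWithᴹ f (block A B C D) (block A′ B′ C′ D′)
        ≋ block (zipWithᴹ f A A′) (zipWithᴹ f B B′) (zipWithᴹ f C C′) (zipWithᴹ f D D′)
    block-zipWith f i j with splitAt n i | splitAt n j
    ... | inj₁ _ | inj₁ _ = ≈-refl
    ... | inj₁ _ | inj₂ _ = ≈-refl
    ... | inj₂ _ | inj₁ _ = ≈-refl
    ... | inj₂ _ | inj₂ _ = ≈-refl

    block-· : ∀ a {A B C D : Mat n} → (a · block A B C D) ≋ block (a · A) (a · B) (a · C) (a · D)
    block-· a i j with splitAt n i | splitAt n j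
    ... | inj₁ _ | inj₁ _ = ≈-refl
    ... | inj₁ _ | inj₂ _ = ≈-refl
    ... | inj₂ _ | inj₁ _ = ≈-refl
    ... | inj₂ _ | inj₂ _ = ≈-refl

    block-ᵀ : ∀ {A B C D : Mat n} → (block A B C D ᵀ) ≋ block (A ᵀ) (C ᵀ) (B ᵀ) (D ᵀ)
    block-ᵀ i j with splitAt n i | splitAt n j
    ... | inj₁ _ | inj₁ _ = ≈-refl
    ... | inj₁ _ | inj₂ _ = ≈-refl
    ... | inj₂ _ | inj₁ _ = ≈-refl
    ... | inj₂ _ | inj₂ _ = ≈-refl

    block-⊗ : ∀ {A B C D A′ B′ C′ D′ : Mat n} →
      (block A B C D ⊗ block A′ B′ C′ D′)
        ≋ block ((A ⊗ A′) ⊕ (B ⊗ C′)) ((A ⊗ B′) ⊕ (B ⊗ D′))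
                ((C ⊗ A′) ⊕ (D ⊗ C′)) ((C ⊗ B′) ⊕ (D ⊗ D′))
    block-⊗ {A} {B} {C} {D} {A′} {B′} {C′} {D′} = block-intro
      (λ i j → entry (i ↑ˡ n) (j ↑ˡ n) (block-↑ˡ-↑ˡ A B C D i) (block-↑ˡ-↑ʳ A B C D i)
                     (λ k → block-↑ˡ-↑ˡ A′ B′ C′ D′ k j) (λ k → block-↑ʳ-↑ˡ A′ B′ C′ D′ k j))
      (λ i j → entry (i ↑ˡ n) (n ↑ʳ j) (block-↑ˡ-↑ˡ A B C D i) (block-↑ˡ-↑ʳ A B C D i)
                     (λ k → block-↑ˡ-↑ʳ A′ B′ C′ D′ k j) (λ k → block-↑ʳ-↑ʳ A′ B′ C′ D′ k j))
      (λ i j → entry (n ↑ʳ i) (j ↑ˡ n) (block-↑ʳ-↑ˡ A B C D i) (block-↑ʳ-↑ʳ A B C D i)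
                     (λ k → block-↑ˡ-↑ˡ A′ B′ C′ D′ k j) (λ k → block-↑ʳ-↑ˡ A′ B′ C′ D′ k j))
      (λ i j → entry (n ↑ʳ i) (n ↑ʳ j) (block-↑ʳ-↑ˡ A B C D i) (block-↑ʳ-↑ʳ A B C D i)
                     (λ k → block-↑ˡ-↑ʳ A′ B′ C′ D′ k j) (λ k → block-↑ʳ-↑ʳ A′ B′ C′ D′ k j))
      where
        M M′ : Mat (n + n)
        M  = block A B C D
        M′ = block A′ B′ C′ D′

        entry : ∀ r s {p q u v : Fin n → Carrier} →
          (∀ k → M r (k ↑ˡ n) ≡ p k) → (∀ k → M r (n ↑ʳ k) ≡ q k) →
          (∀ k → M′ (k ↑ˡ n) s ≡ u k) → (∀ k → M′ (n ↑ʳ k) s ≡ v k) →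
          (M ⊗ M′) r s ≈ sumF (λ k → p k *ᶠ u k) +ᶠ sumF (λ k → q k *ᶠ v k)
        entry r s p≡ q≡ u≡ v≡ = ≈-trans (sumF-splitAt n n _)
          (+-cong (sumF-cong (λ k → reflexive (≡.cong₂ _*ᶠ_ (p≡ k) (u≡ k))))
                  (sumF-cong (λ k → reflexive (≡.cong₂ _*ᶠ_ (q≡ k) (v≡ k)))))

    I-block : I ≋ block {n} I 0M 0M I
    I-block = block-intro
      (λ i j → reflexive (I-injective (↑ˡ-injective n _ _) i j))
      (λ i j → reflexive (I-≢ (↑ˡ≢↑ʳ i j)))
      (λ i j → reflexive (I-≢ (λ eq → ↑ˡ≢↑ʳ j i (≡.sym eq))))
      (λ i j → reflexive (I-injective (↑ʳ-injective n _ _) i j))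

    scalar-block : ∀ a → (a · I) ≋ block {n} (a · I) 0M 0M (a · I)
    scalar-block a = ≋-trans (·-cong a I-block)
      (≋-trans (block-· a) (block-cong ≋-refl a·0≈0 a·0≈0 ≋-refl))
      where
        a·0≈0 : (a · 0M) ≋ 0M {n}
        a·0≈0 i j = zeroʳ a

    constant-block : ∀ x → (λ _ _ → x) ≋ block {n} (λ _ _ → x) (λ _ _ → x) (λ _ _ → x) (λ _ _ → x)
    constant-block x = block-intro (λ _ _ → ≈-refl) (λ _ _ → ≈-refl) (λ _ _ → ≈-refl) (λ _ _ → ≈-refl)

    jordan-block : ∀ h {A B C D A′ B′ C′ D′ : Mat n} →
      jordan h (block A B C D) (block A′ B′ C′ D′)
        ≋ block (half h · (((A ⊗ A′) ⊕ (B ⊗ C′)) ⊕ ((A′ ⊗ A) ⊕ (B′ ⊗ C))))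
                (half h · (((A ⊗ B′) ⊕ (B ⊗ D′)) ⊕ ((A′ ⊗ B) ⊕ (B′ ⊗ D))))
                (half h · (((C ⊗ A′) ⊕ (D ⊗ C′)) ⊕ ((C′ ⊗ A) ⊕ (D′ ⊗ C))))
                (half h · (((C ⊗ B′) ⊕ (D ⊗ D′)) ⊕ ((C′ ⊗ B) ⊕ (D′ ⊗ D))))
    jordan-block h = ≋-trans (·-cong (half h) (⊕-cong block-⊗ block-⊗))
                             (≋-trans (·-cong (half h) (block-zipWith _+ᶠ_)) (block-· (half h)))

module BlockAlgebra {c ℓ p : Level} (F : Field c ℓ) {n : ℕ} (𝒞 : MatrixTheory.Mat F n → Set p) where

  open Field F using (_≈_; 0#; 1#; +-cong; *-cong; zeroˡ)
    renaming (_+_ to _+ᶠ_; _*_ to _*ᶠ_; refl to ≈-refl; trans to ≈-trans)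
  open MatrixTheory F
  open BlockMatrices F
  open Blocks n

  𝒥-zipWith : ∀ f → (∀ {x x′ y y′} → x ≈ x′ → y ≈ y′ → f x y ≈ f x′ y′) →
    (∀ {A B} → 𝒞 A → 𝒞 B → 𝒞 (zipWithᴹ f A B)) →
    ∀ {M M′} → 𝒥 𝒞 M → 𝒥 𝒞 M′ → 𝒥 𝒞 (zipWithᴹ f M M′)
  𝒥-zipWith f f-cong f∈ (A , B , C , A∈ , B∈ , C∈ , M≋) (A′ , B′ , C′ , A′∈ , B′∈ , C′∈ , M′≋) =
    zipWithᴹ f A A′ , zipWithᴹ f B B′ , zipWithᴹ f C C′ , f∈ A∈ A′∈ , f∈ B∈ B′∈ , f∈ C∈ C′∈ ,
    ≋-trans (λ i j → f-cong (M≋ i j) (M′≋ i j)) (block-zipWith f)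

  𝒥-isSubspace : IsSubspace n 𝒞 → IsSubspace (n + n) (𝒥 𝒞)
  𝒥-isSubspace 𝒞-sub = record
    { resp  = λ { M≋N (A , B , C , A∈ , B∈ , C∈ , M≋) → A , B , C , A∈ , B∈ , C∈ , ≋-trans (≋-sym M≋N) M≋ }
    ; zero∈ = 0M , 0M , 0M , zero∈ , zero∈ , zero∈ , constant-block 0#
    ; +∈    = 𝒥-zipWith _+ᶠ_ +-cong +∈
    ; ·∈    = λ { a (A , B , C , A∈ , B∈ , C∈ , M≋) →
        a · A , a · B , a · C , ·∈ a A∈ , ·∈ a B∈ , ·∈ a C∈ , ≋-trans (·-cong a M≋) (block-· a) }
    }
    where open IsSubspace 𝒞-sub

  𝒥-isCoherentJordanAlgebra : ∀ h → IsCoherentAlgebra n 𝒞 → IsCommutative n 𝒞 →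
    IsCoherentJordanAlgebra h (n + n) (𝒥 𝒞)
  𝒥-isCoherentJordanAlgebra h 𝒞-coh 𝒞-comm = record
    { subspace = 𝒥-isSubspace subspace
    ; I∈       = I , 0M , 0M , I∈ , zero∈ , zero∈ , I-block
    ; J∈       = Jm , Jm , Jm , J∈ , J∈ , J∈ , constant-block 1#
    ; ᵀ∈       = λ { (A , B , C , A∈ , B∈ , C∈ , M≋) →
        A ᵀ , C ᵀ , B ᵀ , ᵀ∈ A∈ , ᵀ∈ C∈ , ᵀ∈ B∈ , ≋-trans (λ i j → M≋ j i) block-ᵀ }
    ; ∘∈       = 𝒥-zipWith _*ᶠ_ *-cong ∘∈
    ; ⋆∈       = jordan∈
    }
    where
      open IsCoherentAlgebra 𝒞-coh
      open IsSubspace subspace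

      ½⟨_⊗_⊕_⊗_⟩+⟨_⊗_⊕_⊗_⟩∈ : ∀ {P Q R S T U V W} → 𝒞 P → 𝒞 Q → 𝒞 R → 𝒞 S → 𝒞 T → 𝒞 U → 𝒞 V → 𝒞 W →
        𝒞 (half h · (((P ⊗ Q) ⊕ (R ⊗ S)) ⊕ ((T ⊗ U) ⊕ (V ⊗ W))))
      ½⟨ p ⊗ q ⊕ r ⊗ s ⟩+⟨ t ⊗ u ⊕ v ⊗ w ⟩∈ =
        ·∈ (half h) (+∈ (+∈ (⊗∈ p q) (⊗∈ r s)) (+∈ (⊗∈ t u) (⊗∈ v w)))

      jordan∈ : ∀ {M M′} → 𝒥 𝒞 M → 𝒥 𝒞 M′ → 𝒥 𝒞 (jordan h M M′)
      jordan∈ (A , B , C , A∈ , B∈ , C∈ , M≋) (A′ , B′ , C′ , A′∈ , B′∈ , C′∈ , M′≋) =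
        _ , _ , _ ,
        ½⟨ A∈ ⊗ A′∈ ⊕ B∈ ⊗ C′∈ ⟩+⟨ A′∈ ⊗ A∈ ⊕ B′∈ ⊗ C∈ ⟩∈ ,
        ½⟨ A∈ ⊗ B′∈ ⊕ B∈ ⊗ A′∈ ⟩+⟨ A′∈ ⊗ B∈ ⊕ B′∈ ⊗ A∈ ⟩∈ ,
        ½⟨ C∈ ⊗ A′∈ ⊕ A∈ ⊗ C′∈ ⟩+⟨ C′∈ ⊗ A∈ ⊕ A′∈ ⊗ C∈ ⟩∈ ,
        ≋-trans (jordan-cong h M≋ M′≋)
          (≋-trans (jordan-block h) (block-cong ≋-refl ≋-refl ≋-refl (·-cong (half h) diagonal≋)))
        where
          diagonal≋ : (((C ⊗ B′) ⊕ (A ⊗ A′)) ⊕ ((C′ ⊗ B) ⊕ (A′ ⊗ A)))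
                    ≋ (((A ⊗ A′) ⊕ (B ⊗ C′)) ⊕ ((A′ ⊗ A) ⊕ (B′ ⊗ C)))
          diagonal≋ i j = ≈-trans
            (+-cong (+-cong (𝒞-comm C∈ B′∈ i j) ≈-refl) (+-cong (𝒞-comm C′∈ B∈ i j) ≈-refl))
            (+-rotate _ _ _ _)

  𝒥-isHomogeneous : IsHomogeneous n 𝒞 → IsHomogeneous (n + n) (𝒥 𝒞)
  𝒥-isHomogeneous 𝒞-hom {X} {M} (a , X≋aI) (A , B , C , A∈ , B∈ , C∈ , M≋) with 𝒞-hom (a , ≋-refl) A∈
  ... | b , aI∘A≋bI = b , (begin
    X ∘ M                                                   ≈⟨ ∘-cong (≋-trans X≋aI (scalar-block a)) M≋ ⟩
    (block {n} (a · I) 0M 0M (a · I) ∘ block A B C A)       ≈⟨ block-zipWith _*ᶠ_ ⟩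
    block {n} ((a · I) ∘ A) (0M ∘ B) (0M ∘ C) ((a · I) ∘ A) ≈⟨ block-cong aI∘A≋bI 0∘≈0 0∘≈0 aI∘A≋bI ⟩
    block {n} (b · I) 0M 0M (b · I)                         ≈⟨ scalar-block b ⟨
    b · I                                                   ∎)
    where
      open SetoidReasoning (≋-setoid (n + n))

      0∘≈0 : ∀ {D} → (0M ∘ D) ≋ 0M {n}
      0∘≈0 i j = zeroˡ _

proposition3p4 : ∀ {c ℓ p : Level} (F : Field c ℓ) (h : MatrixTheory.CharNot2 F)
    (n : ℕ) (𝒞 : MatrixTheory.Mat F n → Set p) →
    MatrixTheory.IsCoherentAlgebra F n 𝒞 →
    MatrixTheory.IsCommutative F n 𝒞 →
    MatrixTheory.IsHomogeneous F n 𝒞 →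
    MatrixTheory.IsCoherentJordanAlgebra F h (n + n) (MatrixTheory.𝒥 F 𝒞)
      × MatrixTheory.IsHomogeneous F (n + n) (MatrixTheory.𝒥 F 𝒞)
proposition3p4 F h n 𝒞 𝒞-coh 𝒞-comm 𝒞-hom =
  𝒥-isCoherentJordanAlgebra h 𝒞-coh 𝒞-comm , 𝒥-isHomogeneous 𝒞-hom
  where open BlockAlgebra F 𝒞
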